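{- Every finite tree has a canonical ESD labeling.
   Context: For a graph $G=(V,E)$ and $l\in\mathbb N$, a vertex labeling $\phi:V\to\{1,\dots,l\}$ is an edge-sum distinguishing (ESD) labeling if $\phi$ is injective and the edge-weights $w_\phi(uv)=\phi(u)+\phi(v)$ are pairwise distinct over all edges $uv\in E$. It is a canonical ESD labeling if $l=|V|$. -}

module Defs where

open import Level using (0ℓ)
open import Data.Nat using (ℕ; suc; _+_; _≤_)
open import Data.Fin using (Fin)
open import Data.List using (List; []; _∷_; length)
open import Data.List.Relation.Unary.Unique.Propositional using (Unique)
open import Data.Product using (_×_; Σ-syntax)
open import Data.Sum using (_⊎_)
open import Data.Empty using (⊥)
open import Data.Unit using (⊤)
open import Relation.Nullary using (¬_)
open import Relation.Binary.PropositionalEquality using (_≡_)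
open import Relation.Binary.Construct.Closure.ReflexiveTransitive using (Star)
open import Function.Definitions using (Injective)

record SimpleGraph (n : ℕ) : Set₁ where
  field
    Adj     : Fin n → Fin n → Set
    symm    : ∀ {u v} → Adj u v → Adj v u
    irrefl  : ∀ {u} → ¬ Adj u u
open SimpleGraph public

Connected : ∀ {n} → SimpleGraph n → Set
Connected {n} G = (u v : Fin n) → Star (Adj G) u v

Chain : ∀ {n} → SimpleGraph n → List (Fin n) → Set
Chain G []           = ⊤
Chain G (v ∷ [])     = ⊤
Chain G (u ∷ v ∷ vs) = Adj G u v × Chain G (v ∷ vs)

last : ∀ {A : Set} → A → List A → A
last a []       = a
last a (b ∷ bs) = last b bs

IsCycle : ∀ {n} → SimpleGraph n → List (Fin n) → Set
IsCycle G []       = ⊥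
IsCycle G (v ∷ vs) =
  (3 ≤ length (v ∷ vs)) × Unique (v ∷ vs) × Chain G (v ∷ vs) × Adj G (last v vs) v

Acyclic : ∀ {n} → SimpleGraph n → Set
Acyclic {n} G = (c : List (Fin n)) → ¬ IsCycle G c

IsTree : ∀ {n} → SimpleGraph n → Set
IsTree {n} G = (1 ≤ n) × Connected G × Acyclic G

weight : ∀ {n} → (Fin n → ℕ) → Fin n → Fin n → ℕ
weight φ u v = φ u + φ v

IsESDLabeling : ∀ {n} → SimpleGraph n → ℕ → (Fin n → ℕ) → Set
IsESDLabeling {n} G l φ =
  ((v : Fin n) → (1 ≤ φ v) × (φ v ≤ l))
  × Injective _≡_ _≡_ φ
  × (∀ {u v x y} → Adj G u v → Adj G x y → weight φ u v ≡ weight φ x y →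
       (u ≡ x × v ≡ y) ⊎ (u ≡ y × v ≡ x))

IsCanonicalESDLabeling : ∀ {n} → SimpleGraph n → (Fin n → ℕ) → Set
IsCanonicalESDLabeling {n} G φ = IsESDLabeling G n φ

module Submission where

-- Root the tree at a vertex r.  Every vertex v has a unique simple
-- path v, p(v), …, r to the root, and every edge joins a vertex c to its
-- parent p(c).  Read the path of v as a base-(n+1) numeral whose lowest
-- digit is v; this key is injective, and key c = digit c + key (p c)·(n+1),
-- so ordering the children by key orders their parents weakly in the same
-- way.  Labelling each vertex by its rank in the key order therefore gives
-- an injective labeling into {1,…,n} under which c ↦ rank c + rank (p c) is
-- strictly increasing along the key order; that is the ESD property.

open import Defs
open import Data.Nat using (ℕ; zero; suc; _+_; _*_; _≤_; _<_; z≤n; s≤s; _<?_)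
open import Data.Nat.Properties
open import Data.Fin using (Fin; toℕ) renaming (zero to fzero)
open import Data.Fin.Properties using (toℕ<n; toℕ-injective) renaming (_≟_ to _≟ᶠ_)
open import Data.Product using (Σ-syntax; _×_; _,_; proj₁; proj₂)
open import Data.Sum using (_⊎_; inj₁; inj₂)
open import Data.Empty using (⊥-elim)
open import Data.Unit using (⊤; tt)
open import Data.List using (List; []; _∷_; length; allFin)
open import Data.List.Properties using (∷-injectiveˡ; ∷-injectiveʳ; length-tabulate)
open import Data.List.Relation.Unary.All using (All; []; _∷_; lookup)
open import Data.List.Relation.Unary.Any using (here; there)
open import Data.List.Relation.Unary.AllPairs using ([]; _∷_)
open import Data.List.Relation.Unary.Unique.Propositional using (Unique)
open import Data.List.Membership.Propositional using (_∈_)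
open import Data.List.Membership.Propositional.Properties using (∈-allFin)
open import Relation.Nullary using (¬_; yes; no)
open import Relation.Binary using (tri<; tri≈; tri>)
open import Relation.Binary.PropositionalEquality
open import Relation.Binary.Construct.Closure.ReflexiveTransitive using (Star; ε; _◅_)
open import Function.Definitions using (Injective)

leading-dominates : ∀ {B c c′ a a′} → c < B → c′ < B → a < a′ →
                    c + a * B < c′ + a′ * B
leading-dominates {B} {c} {c′} {a} {a′} c<B c′<B a<a′ = begin-strict
  c + a * B   <⟨ +-monoˡ-< (a * B) c<B ⟩
  B + a * B   ≤⟨ *-monoˡ-≤ B a<a′ ⟩
  a′ * B      ≤⟨ m≤n+m (a′ * B) c′ ⟩
  c′ + a′ * B ∎
  where open ≤-Reasoning

leading-≤ : ∀ {B c c′ a a′} → c < B → c′ < B →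
            c + a * B < c′ + a′ * B → a ≤ a′
leading-≤ {a = a} {a′} c<B c′<B lt with a ≤? a′
... | yes a≤a′ = a≤a′
... | no  a≰a′ = ⊥-elim (<-asym lt (leading-dominates c′<B c<B (≰⇒> a≰a′)))

numeral-injective : ∀ {B c c′ a a′} → c < B → c′ < B →
                    c + a * B ≡ c′ + a′ * B → c ≡ c′ × a ≡ a′
numeral-injective {B} {c} {c′} {a} {a′} c<B c′<B eq with <-cmp a a′
... | tri< lt _ _    = ⊥-elim (<-irrefl eq (leading-dominates c<B c′<B lt))
... | tri> _ _ gt    = ⊥-elim (<-irrefl (sym eq) (leading-dominates c′<B c<B gt))
... | tri≈ _ refl _ = +-cancelʳ-≡ (a * B) c c′ eq , refl

module Numerals {n : ℕ} where

  -- Lists of vertices read as base-(n+1) numerals, head = lowest digit;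
  -- the digit of x is 1 + x, so that different lengths never collide.
  base : ℕ
  base = suc n

  digit< : (x : Fin n) → suc (toℕ x) < base
  digit< x = s≤s (toℕ<n x)

  encode : List (Fin n) → ℕ
  encode []       = 0
  encode (x ∷ xs) = suc (toℕ x) + encode xs * base

  encode-injective : ∀ xs ys → encode xs ≡ encode ys → xs ≡ ys
  encode-injective []       []       _ = refl
  encode-injective (x ∷ xs) (y ∷ ys) eq
    with numeral-injective (digit< x) (digit< y) eq
  ... | x≡y , rest = cong₂ _∷_ (toℕ-injective (suc-injective x≡y))
                               (encode-injective xs ys rest)

module Ranks {A : Set} (key : A → ℕ) where

  below : ℕ → List A → ℕ
  below t [] = 0
  below t (x ∷ xs) with key x <? t
  ... | yes _ = suc (below t xs)
  ... | no  _ = below t xs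

  below-≤-length : ∀ t xs → below t xs ≤ length xs
  below-≤-length t [] = z≤n
  below-≤-length t (x ∷ xs) with key x <? t
  ... | yes _ = s≤s (below-≤-length t xs)
  ... | no  _ = m≤n⇒m≤1+n (below-≤-length t xs)

  below-<-length : ∀ {x} t xs → x ∈ xs → ¬ key x < t → below t xs < length xs
  below-<-length t (y ∷ xs) (here refl) ¬y<t with key y <? t
  ... | yes y<t = ⊥-elim (¬y<t y<t)
  ... | no  _   = s≤s (below-≤-length t xs)
  below-<-length t (y ∷ xs) (there x∈xs) ¬x<t with key y <? t
  ... | yes _ = s≤s (below-<-length t xs x∈xs ¬x<t)
  ... | no  _ = m≤n⇒m≤1+n (below-<-length t xs x∈xs ¬x<t)

  below-mono : ∀ {t t′} xs → t ≤ t′ → below t xs ≤ below t′ xs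
  below-mono [] _ = z≤n
  below-mono {t} {t′} (x ∷ xs) t≤t′ with key x <? t | key x <? t′
  ... | yes _   | yes _    = s≤s (below-mono xs t≤t′)
  ... | yes x<t | no ¬x<t′ = ⊥-elim (¬x<t′ (<-≤-trans x<t t≤t′))
  ... | no _    | yes _    = m≤n⇒m≤1+n (below-mono xs t≤t′)
  ... | no _    | no _     = below-mono xs t≤t′

  below-strict : ∀ {x t t′} xs → t < t′ → x ∈ xs → key x ≡ t →
                 below t xs < below t′ xs
  below-strict {t = t} {t′} (y ∷ xs) t<t′ (here refl) refl with key y <? t | key y <? t′
  ... | yes y<y | _        = ⊥-elim (<-irrefl refl y<y)
  ... | no _    | yes _    = s≤s (below-mono xs (<⇒≤ t<t′))
  ... | no _    | no ¬y<t′ = ⊥-elim (¬y<t′ t<t′)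
  below-strict {t = t} {t′} (y ∷ xs) t<t′ (there x∈xs) refl with key y <? t | key y <? t′
  ... | yes _   | yes _    = s≤s (below-strict xs t<t′ x∈xs refl)
  ... | yes y<t | no ¬y<t′ = ⊥-elim (¬y<t′ (<-trans y<t t<t′))
  ... | no _    | yes _    = m≤n⇒m≤1+n (below-strict xs t<t′ x∈xs refl)
  ... | no _    | no _     = below-strict xs t<t′ x∈xs refl

module VertexRanks {n : ℕ} (key : Fin n → ℕ) where
  open Ranks key

  rank : Fin n → ℕ
  rank v = suc (below (key v) (allFin n))

  rank-mono : ∀ {v w} → key v ≤ key w → rank v ≤ rank w
  rank-mono k≤ = s≤s (below-mono (allFin n) k≤)

  rank-strict : ∀ {v w} → key v < key w → rank v < rank w
  rank-strict {v} k< = s≤s (below-strict (allFin n) k< (∈-allFin v) refl)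

  rank-≤-n : ∀ v → rank v ≤ n
  rank-≤-n v = subst (rank v ≤_) (length-tabulate (λ x → x))
    (below-<-length (key v) (allFin n) (∈-allFin v) (<-irrefl refl))

  rank-injective : (∀ {v w} → key v ≡ key w → v ≡ w) → Injective _≡_ _≡_ rank
  rank-injective key-inj {v} {w} eq with <-cmp (key v) (key w)
  ... | tri< lt _ _  = ⊥-elim (<-irrefl eq (rank-strict lt))
  ... | tri≈ _ kv≡ _ = key-inj kv≡
  ... | tri> _ _ gt  = ⊥-elim (<-irrefl (sym eq) (rank-strict gt))

module ParentCriterion
  {n : ℕ} (G : SimpleGraph n) (key : Fin n → ℕ)
  (key-injective : ∀ {v w} → key v ≡ key w → v ≡ w)
  (Parent : Fin n → Fin n → Set)
  (edge-oriented : ∀ {u v} → Adj G u v → Parent u v ⊎ Parent v u)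
  (parent-unique : ∀ {c p q} → Parent c p → Parent c q → p ≡ q)
  (parent-monotone : ∀ {c p d q} → Parent c p → Parent d q →
                     key c < key d → key p ≤ key q)
  where
  open VertexRanks key

  weight-monotone : ∀ {c p d q} → Parent c p → Parent d q → key c < key d →
                    rank c + rank p < rank d + rank q
  weight-monotone c→p d→q lt =
    +-mono-<-≤ (rank-strict lt) (rank-mono (parent-monotone c→p d→q lt))

  weight-determines : ∀ {c p d q} → Parent c p → Parent d q →
                      rank c + rank p ≡ rank d + rank q → c ≡ d × p ≡ q
  weight-determines {c} {d = d} c→p d→q eq with <-cmp (key c) (key d)
  ... | tri< lt _ _  = ⊥-elim (<-irrefl eq (weight-monotone c→p d→q lt))
  ... | tri> _ _ gt  = ⊥-elim (<-irrefl (sym eq) (weight-monotone d→q c→p gt))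
  ... | tri≈ _ kc≡ _ with key-injective kc≡
  ... | refl = refl , parent-unique c→p d→q

  rank-is-canonical-ESD : IsCanonicalESDLabeling G rank
  rank-is-canonical-ESD = (λ v → s≤s z≤n , rank-≤-n v) , rank-injective key-injective , distinct
    where
    flip : ∀ a b → rank a + rank b ≡ rank b + rank a
    flip a b = +-comm (rank a) (rank b)

    distinct : ∀ {u v x y} → Adj G u v → Adj G x y → weight rank u v ≡ weight rank x y →
               (u ≡ x × v ≡ y) ⊎ (u ≡ y × v ≡ x)
    distinct {u} {v} {x} {y} uv xy eq with edge-oriented uv | edge-oriented xy
    ... | inj₁ u→v | inj₁ x→y = inj₁ (weight-determines u→v x→y eq)
    ... | inj₁ u→v | inj₂ y→x = inj₂ (weight-determines u→v y→x (trans eq (flip x y)))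
    ... | inj₂ v→u | inj₁ x→y with weight-determines v→u x→y (trans (flip v u) eq)
    ...   | v≡x , u≡y = inj₂ (u≡y , v≡x)
    distinct {u} {v} {x} {y} uv xy eq | inj₂ v→u | inj₂ y→x
      with weight-determines v→u y→x (trans (flip v u) (trans eq (flip x y)))
    ...   | v≡y , u≡x = inj₁ (u≡x , v≡y)

module Paths {n : ℕ} (G : SimpleGraph n) where

  V : Set
  V = Fin n

  open import Data.List.Membership.DecPropositional (_≟ᶠ_ {n}) using (_∈?_)

  data Walk (P : V → Set) : V → V → Set where
    stop : ∀ {a} → P a → Walk P a a
    step : ∀ {a c b} → P a → Adj G a c → Walk P c b → Walk P a b

  data Trail : V → V → List V → Set where
    stop : ∀ {a} → Trail a a (a ∷ [])
    step : ∀ {a c b xs} → Adj G a c → Trail c b (c ∷ xs) → Trail a b (a ∷ c ∷ xs)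

  first : ∀ {P a b} → Walk P a b → P a
  first (stop pa)     = pa
  first (step pa _ _) = pa

  _++ʷ_ : ∀ {P a b c} → Walk P a b → Walk P b c → Walk P a c
  stop _      ++ʷ w = w
  step pa h w ++ʷ w′ = step pa h (w ++ʷ w′)

  reverseʷ : ∀ {P a b} → Walk P a b → Walk P b a
  reverseʷ (stop pa)     = stop pa
  reverseʷ (step pa h w) = reverseʷ w ++ʷ step (first w) (symm G h) (stop pa)

  fromStar : ∀ {a b} → Star (Adj G) a b → Walk (λ _ → ⊤) a b
  fromStar ε       = stop tt
  fromStar (h ◅ s) = step tt h (fromStar s)

  toWalk : ∀ {Q : V → Set} {a b xs} → Trail a b xs → All Q xs → Walk Q a b
  toWalk stop       (q ∷ []) = stop q
  toWalk (step h t) (q ∷ qs) = step q h (toWalk t qs)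

  extend : ∀ {a c b ys} → Adj G a c → Trail c b ys → Trail a b (a ∷ ys)
  extend h stop         = step h stop
  extend h (step h′ t) = step h (step h′ t)

  starts-with : ∀ {a b xs} → Trail a b xs → Σ[ ys ∈ List V ] xs ≡ a ∷ ys
  starts-with stop       = _ , refl
  starts-with (step _ _) = _ , refl

  ends-in : ∀ {a b xs} → Trail a b xs → b ∈ xs
  ends-in stop       = here refl
  ends-in (step _ t) = there (ends-in t)

  trail-chain : ∀ {a b xs} → Trail a b xs → Chain G xs
  trail-chain stop       = tt
  trail-chain (step h t) = h , trail-chain t

  trail-last : ∀ {a b x xs} → Trail a b (x ∷ xs) → last x xs ≡ b
  trail-last stop       = refl
  trail-last (step _ t) = trail-last t

  ∉⇒all-≢ : ∀ {a : V} zs → ¬ a ∈ zs → All (λ z → ¬ a ≡ z) zs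
  ∉⇒all-≢ []       _   = []
  ∉⇒all-≢ (z ∷ zs) a∉ = (λ e → a∉ (here e)) ∷ ∉⇒all-≢ zs (λ m → a∉ (there m))

  PathIn : (P : V → Set) → V → V → Set
  PathIn P a b = Σ[ xs ∈ List V ] (Trail a b xs × Unique xs × All P xs)

  suffix : ∀ {P a c b ys} → Trail c b ys → Unique ys → All P ys → a ∈ ys → PathIn P a b
  suffix stop       u ps (here refl)             = _ , stop , u , ps
  suffix (step h t) u ps (here refl)             = _ , step h t , u , ps
  suffix (step h t) (_ ∷ u) (_ ∷ ps) (there a∈) = suffix t u ps a∈

  loop-erase : ∀ {P a b} → Walk P a b → PathIn P a b
  loop-erase (stop pa) = _ , stop , [] ∷ [] , pa ∷ []
  loop-erase {a = a} (step pa h w) with loop-erase w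
  ... | ys , t , u , ps with a ∈? ys
  ...   | yes a∈ys = suffix t u ps a∈ys
  ...   | no  a∉ys = a ∷ ys , extend h t , ∉⇒all-≢ ys a∉ys ∷ u , pa ∷ ps

  -- In an acyclic graph two paths with the same endpoints are equal:
  -- if they leave a through different neighbours c₁ ≠ c₂, joining them
  -- gives a walk c₁ → c₂ avoiding a, whose loop erasure closes a cycle
  -- through a.
  paths-unique : Acyclic G → ∀ {a b xs ys} →
                 Trail a b xs → Unique xs → Trail a b ys → Unique ys → xs ≡ ys
  paths-unique acyc stop _ stop _ = refl
  paths-unique acyc stop _ (step _ t) (a∉ ∷ _) = ⊥-elim (lookup a∉ (ends-in t) refl)
  paths-unique acyc (step _ t) (a∉ ∷ _) stop _ = ⊥-elim (lookup a∉ (ends-in t) refl)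
  paths-unique acyc {a} (step {c = c₁} h₁ t₁) (a∉₁ ∷ u₁) (step {c = c₂} h₂ t₂) (a∉₂ ∷ u₂)
    with c₁ ≟ᶠ c₂
  ... | yes refl = cong (a ∷_) (paths-unique acyc t₁ u₁ t₂ u₂)
  ... | no c₁≢c₂ with loop-erase (toWalk t₁ a∉₁ ++ʷ reverseʷ (toWalk t₂ a∉₂))
  ...   | _ , stop , _ , _ = ⊥-elim (c₁≢c₂ refl)
  ...   | zs@(_ ∷ _ ∷ _) , step h t , u , a∉ =
    ⊥-elim (acyc (a ∷ zs) (s≤s (s≤s (s≤s z≤n)) , a∉ ∷ u , (h₁ , trail-chain (step h t)) ,
      subst (λ z → Adj G z a) (sym (trail-last (step h t))) (symm G h₂)))

module RootedTree {n : ℕ} (G : SimpleGraph n) (conn : Connected G) (acyc : Acyclic G)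
                  (r : Fin n) where
  open Paths G
  open Numerals {n}
  open import Data.List.Membership.DecPropositional (_≟ᶠ_ {n}) using (_∈?_)

  to-root : (v : V) → PathIn (λ _ → ⊤) v r
  to-root v = loop-erase (fromStar (conn v r))

  path : V → List V
  path v = proj₁ (to-root v)

  path-trail : ∀ v → Trail v r (path v)
  path-trail v = proj₁ (proj₂ (to-root v))

  path-unique : ∀ v → Unique (path v)
  path-unique v = proj₁ (proj₂ (proj₂ (to-root v)))

  is-path : ∀ {v xs} → Trail v r xs → Unique xs → path v ≡ xs
  is-path t u = paths-unique acyc (path-trail _) (path-unique _) t u

  path-injective : ∀ {v w} → path v ≡ path w → v ≡ w
  path-injective {v} {w} eq with starts-with (path-trail v) | starts-with (path-trail w)
  ... | _ , pv≡ | _ , pw≡ = ∷-injectiveˡ (trans (sym pv≡) (trans eq pw≡))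

  Parent : V → V → Set
  Parent c p = path c ≡ c ∷ path p

  parent-unique : ∀ {c p q} → Parent c p → Parent c q → p ≡ q
  parent-unique c→p c→q = path-injective (∷-injectiveʳ (trans (sym c→p) c→q))

  -- For an edge u–w: if w is not on the path of u, then w, path u is the
  -- path of w; otherwise w follows u on it and u, path w is the path of u.
  edge-oriented : ∀ {u w} → Adj G u w → Parent u w ⊎ Parent w u
  edge-oriented {u} {w} h = orient (path-trail u) (path-unique u) refl
    where
    orient : ∀ {xs} → Trail u r xs → Unique xs → path u ≡ xs → Parent u w ⊎ Parent w u
    orient {xs} t u-xs pu≡ with w ∈? xs
    orient {xs} t u-xs pu≡ | no w∉xs =
      inj₂ (trans (is-path (extend (symm G h) t) (∉⇒all-≢ xs w∉xs ∷ u-xs)) (cong (w ∷_) (sym pu≡)))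
    orient stop       _ _ | yes (here refl) = ⊥-elim (irrefl G h)
    orient (step _ _) _ _ | yes (here refl) = ⊥-elim (irrefl G h)
    orient (step _ t) (u∉ ∷ u-xs) _ | yes (there w∈) with suffix t u-xs u∉ w∈
    ... | zs , tw , uz , u∉zs =
      inj₁ (trans (is-path (extend h tw) (u∉zs ∷ uz)) (cong (u ∷_) (sym (is-path tw uz))))

  key : V → ℕ
  key v = encode (path v)

  key-injective : ∀ {v w} → key v ≡ key w → v ≡ w
  key-injective eq = path-injective (encode-injective _ _ eq)

  key-parent : ∀ {c p} → Parent c p → key c ≡ suc (toℕ c) + key p * base
  key-parent c→p = cong encode c→p

  parent-monotone : ∀ {c p d q} → Parent c p → Parent d q → key c < key d → key p ≤ key q
  parent-monotone {c} {d = d} c→p d→q lt =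
    leading-≤ (digit< c) (digit< d) (subst₂ _<_ (key-parent c→p) (key-parent d→q) lt)

theorem5 : (n : ℕ) (G : SimpleGraph n) → IsTree G →
    Σ[ φ ∈ (Fin n → ℕ) ] IsCanonicalESDLabeling G φ
theorem5 zero    G (() , _)
theorem5 (suc m) G (_ , conn , acyc) = rank , rank-is-canonical-ESD
  where
  open RootedTree G conn acyc fzero
  open ParentCriterion G key key-injective Parent edge-oriented parent-unique parent-monotone
  open VertexRanks key using (rank)
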